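{- Let $n\ge 2$, let $E=(S_1,\dots,S_T)$ be any sequence of non-empty hyperedges $S_t\subseteq[n]$, and consider any execution (any outcome of the random choices) of the algorithm RAND described in the context on $E$. Let $\ell\ge 0$ be an integer. If every node has completed phase $\ell$, then the number of fully used colors, $\mathrm{RAND}(E)$, satisfies $\mathrm{RAND}(E)\ge 2^{\ell-1}$.
   Context: Nodes are $[n]$. Hyperedges $S_1,\dots,S_T\subseteq[n]$ arrive online, and each receives a color (a positive integer). A node $i$ gathers color $r$ if $i$ belongs to a hyperedge colored $r$. A color is fully used if all $n$ nodes have gathered it. Parameters: $h=\lceil\log_2 n\rceil$. For every integer $k\ge0$, let $R_k=\{2^k,2^k+1,\dots,2^{k+1}-1\}$, so $|R_k|=2^k$, and let $q_k=\lceil(1-\tfrac{1}{2n})\,2^k\rceil$. Algorithm RAND. For each node $i$ it maintains a phase $p(i)$, initially $0$, and for each integer $k\ge0$ a set $C_{i,k}$, initially empty. When a hyperedge $S$ arrives, RAND does the following. - Let $p_S=\min_{i\in S}p(i)$, using the current phases. - Sample $k^*$ uniformly at random from $\{p_S,p_S+1,\dots,p_S+h-1\}$. - Sample a color $r$ uniformly at random from $R_{k^*}$, and color $S$ with $r$. - For each node $i\in S$, in turn: set $C_{i,k^*}\leftarrow C_{i,k^*}\cup\{r\}$; then, if $|C_{i,p(i)}|\ge q_{p(i)}$, set $p(i)\leftarrow p(i)+1$. A node $i$ has completed phase $\ell$ if its phase at the end of the input satisfies $p(i)\ge \ell+1$. -}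

module Defs where

open import Data.Nat using (ℕ; zero; suc; _+_; _*_; _∸_; _^_; _≤_; _<_; _⊓_; _≟_; _≤ᵇ_)
open import Data.Nat.DivMod using (_/_)
open import Data.Nat.Logarithm using (⌈log₂_⌉)
open import Data.Bool using (Bool; true; false; if_then_else_)
open import Data.Fin using (Fin)
open import Data.Fin.Subset using (Subset; _∈_)
import Data.Fin.Subset.Properties as SP
import Data.Fin.Properties as FP
open import Data.List using (List; []; _∷_; length; filter; map; zip; foldr; deduplicate)
open import Data.List.Relation.Unary.Any using (Any; any?)
import Data.List.Membership.DecPropositional as DM
open import Data.Product using (_×_; _,_; proj₁; proj₂)
open import Data.Product.Properties using ()
open import Relation.Nullary using (Dec; yes; no; does)
open import Relation.Nullary.Decidable using (_×-dec_)
open import Relation.Binary.PropositionalEquality using (_≡_)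
open import Data.Unit using (⊤)

hParam : ℕ → ℕ
hParam n = ⌈log₂ n ⌉

ceilDivSuc : ℕ → ℕ → ℕ
ceilDivSuc a d = (a + d) / suc d

-- q_k = ⌈ (1 - 1/(2n)) 2^k ⌉ = ⌈ (2n-1) 2^k / (2n) ⌉   (for n ≥ 1, 2n = suc (2n-1))
qParam : ℕ → ℕ → ℕ
qParam n k = ceilDivSuc ((2 * n ∸ 1) * 2 ^ k) (2 * n ∸ 1)

-- finite sets of colors, represented as duplicate-free lists
insertColor : ℕ → List ℕ → List ℕ
insertColor r xs with DM._∈?_ _≟_ r xs
... | yes _ = xs
... | no  _ = r ∷ xs

record State (n : ℕ) : Set where
  field
    phase : Fin n → ℕ
    C     : Fin n → ℕ → List ℕ
open State public

initState : (n : ℕ) → State n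
initState n = record { phase = λ _ → 0 ; C = λ _ _ → [] }

isIn : {n : ℕ} → Fin n → Subset n → Bool
isIn i S = does (SP._∈?_ i S)

-- minimum of a list, with the default 0 for the empty list (never used for non-empty S)
minList : List ℕ → ℕ
minList []       = 0
minList (x ∷ xs) = foldr _⊓_ x xs

pS : {n : ℕ} → State n → Subset n → ℕ
pS {n} st S = minList (map (phase st) (filter (λ i → SP._∈?_ i S) (Data.List.allFin n)))
  where import Data.List

step : {n : ℕ} → State n → Subset n → ℕ → ℕ → State n
step {n} st S k r = record { phase = newPhase ; C = newC }
  where
  newC : Fin n → ℕ → List ℕ
  newC i j with isIn i S | j ≟ k
  ... | true | yes _ = insertColor r (C st i j)
  ... | _    | _     = C st i j
  newPhase : Fin n → ℕ
  newPhase i with isIn i S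
  ... | false = phase st i
  ... | true  = if qParam n (phase st i) ≤ᵇ length (newC i (phase st i))
                then suc (phase st i) else phase st i

run : {n : ℕ} → State n → List (Subset n × ℕ × ℕ) → State n
run st []                  = st
run st ((S , k , r) ∷ xs) = run (step st S k r) xs

-- the random choices are a possible outcome of RAND:
-- k* ∈ {p_S, …, p_S + h - 1} and r ∈ R_{k*} = {2^k*, …, 2^(k*+1) - 1}
ValidRun : {n : ℕ} → State n → List (Subset n × ℕ × ℕ) → Set
ValidRun st [] = ⊤
ValidRun {n} st ((S , k , r) ∷ xs) =
  (pS st S ≤ k × k < pS st S + hParam n) ×
  (2 ^ k ≤ r × r < 2 ^ suc k) ×
  ValidRun (step st S k r) xs

FullyUsed : {n : ℕ} → List (Subset n × ℕ × ℕ) → ℕ → Set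
FullyUsed {n} xs c = (i : Fin n) → Any (λ e → i ∈ proj₁ e × proj₂ (proj₂ e) ≡ c) xs

fullyUsed? : {n : ℕ} → (xs : List (Subset n × ℕ × ℕ)) → (c : ℕ) → Dec (FullyUsed xs c)
fullyUsed? xs c = FP.all? (λ i → any? (λ e → SP._∈?_ i (proj₁ e) ×-dec (proj₂ (proj₂ e) ≟ c)) xs)

randValue : {n : ℕ} → List (Subset n × ℕ × ℕ) → ℕ
randValue xs = length (filter (fullyUsed? xs) (deduplicate _≟_ (map (λ e → proj₂ (proj₂ e)) xs)))

{-# OPTIONS --safe #-}
-- Once every node has completed phase ℓ, each node i has gathered at least q_ℓ colors
-- of the block R_ℓ: the sets C_{i,ℓ} are duplicate-free, only receive colors of R_ℓ,
-- and phase ℓ is left only when |C_{i,ℓ}| ≥ q_ℓ.  Hence each node misses at most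
-- 2^ℓ − q_ℓ ≤ 2^ℓ / (2n) colors of R_ℓ, and by the union bound at most half of R_ℓ is
-- missed by some node.  Every other color of R_ℓ is in every C_{i,ℓ}, and a color enters
-- C_{i,ℓ} only through a hyperedge containing i, so these at least 2^(ℓ−1) colors
-- are fully used.
module Submission where

open import Defs
open import Data.Bool using (true; false; if_then_else_; T)
open import Data.Fin using (Fin; zero)
open import Data.Fin.Subset using (Subset; Nonempty) renaming (_∈_ to _∈ₛ_)
import Data.Fin.Subset.Properties as Subset
open import Data.List using (List; []; _∷_; length; filter; map; zip; applyUpTo; allFin)
open import Data.List.Properties
  using (length-applyUpTo; length-removeAt′; length-tabulate; filter-all)
open import Data.List.Membership.Propositional using (_∈_; _─_)
open import Data.List.Membership.Propositional.Properties
  using (∈-applyUpTo⁺; ∈-filter⁺; ∈-filter⁻; ∈-deduplicate⁺; ∈-allFin)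
open import Data.List.Relation.Binary.Subset.Propositional using (_⊆_)
open import Data.List.Relation.Unary.All as All using (All; []; _∷_; all?)
open import Data.List.Relation.Unary.All.Properties using (¬Any⇒All¬)
open import Data.List.Relation.Unary.AllPairs using ([]; _∷_)
open import Data.List.Relation.Unary.Any as Any using (Any; here; there)
import Data.List.Relation.Unary.Any.Properties as Any
open import Data.List.Relation.Unary.Unique.Propositional using (Unique)
import Data.List.Relation.Unary.Unique.Propositional.Properties as Unique
open import Data.Nat using (ℕ; suc; _+_; _*_; _∸_; _^_; _≤_; _<_; z≤n; s≤s; s≤s⁻¹; _≟_)
open import Data.Nat.DivMod using (_%_; m≡m%n+[m/n]*n; m%n<n)
open import Data.Nat.Properties
open import Data.Product as Product using (_×_; _,_; proj₂)
open import Data.Sum as Sum using (_⊎_; inj₁; inj₂; [_,_])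
open import Function using (_∘_; id)
open import Relation.Nullary using (yes; no; contradiction)
open import Relation.Unary using (Pred; Decidable)
open import Relation.Unary.Properties using (∁?)
open import Relation.Binary.PropositionalEquality
  using (_≡_; _≢_; refl; sym; trans; cong; subst; subst₂)

open import Data.List.Membership.DecPropositional _≟_ using (_∈?_)

module _ {a} {A : Set a} where

  ∈-─ : ∀ {x z : A} {ys} (x∈ys : x ∈ ys) → z ∈ ys → z ≢ x → z ∈ ys ─ x∈ys
  ∈-─ (here refl)  (here refl)  z≢x = contradiction refl z≢x
  ∈-─ (here refl)  (there z∈ys) _   = z∈ys
  ∈-─ (there _)    (here refl)  _   = here refl
  ∈-─ (there x∈ys) (there z∈ys) z≢x = there (∈-─ x∈ys z∈ys z≢x)

  Unique-⊆⇒length≤ : ∀ {xs ys : List A} → Unique xs → xs ⊆ ys → length xs ≤ length ys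
  Unique-⊆⇒length≤ {[]}          _            _     = z≤n
  Unique-⊆⇒length≤ {x ∷ xs} {ys} (x≢xs ∷ uxs) xs⊆ys = begin
    suc (length xs)          ≤⟨ s≤s (Unique-⊆⇒length≤ uxs xs⊆ys─x) ⟩
    suc (length (ys ─ x∈ys)) ≡⟨ length-removeAt′ ys _ ⟨
    length ys                ∎
    where
    open ≤-Reasoning
    x∈ys = xs⊆ys (here refl)
    xs⊆ys─x : xs ⊆ ys ─ x∈ys
    xs⊆ys─x z∈xs = ∈-─ x∈ys (xs⊆ys (there z∈xs)) (λ z≡x → All.lookup x≢xs z∈xs (sym z≡x))

module _ {a p} {A : Set a} {P : Pred A p} (P? : Decidable P) where

  length-filter-split : ∀ xs → length (filter P? xs) + length (filter (∁? P?) xs) ≡ length xs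
  length-filter-split []       = refl
  length-filter-split (x ∷ xs) with ih ← length-filter-split xs | P? x
  ... | yes _ = cong suc ih
  ... | no  _ = trans (+-suc _ _) (cong suc ih)

  length-filter-∁≤ : ∀ {xs ys} → Unique ys → ys ⊆ xs → (∀ {y} → y ∈ ys → P y) →
                     length (filter (∁? P?) xs) ≤ length xs ∸ length ys
  length-filter-∁≤ {xs} {ys} uys ys⊆xs P-ys = begin
    length misses                              ≡⟨ m+n∸m≡n (length hits) _ ⟨
    length hits + length misses ∸ length hits  ≡⟨ cong (_∸ length hits) (length-filter-split xs) ⟩
    length xs ∸ length hits                    ≤⟨ ∸-monoʳ-≤ (length xs) ys≤hits ⟩
    length xs ∸ length ys                      ∎
    where
    open ≤-Reasoning
    hits   = filter P? xs
    misses = filter (∁? P?) xs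
    ys≤hits : length ys ≤ length hits
    ys≤hits = Unique-⊆⇒length≤ uys (λ y∈ys → ∈-filter⁺ P? (ys⊆xs y∈ys) (P-ys y∈ys))

  module _ {q r} {Q : Pred A q} {R : Pred A r} (Q? : Decidable Q) (R? : Decidable R)
           (P∩Q⊆R : ∀ {x} → P x → Q x → R x) where

    length-filter≤filter+∁ :
      ∀ xs → length (filter P? xs) ≤ length (filter R? xs) + length (filter (∁? Q?) xs)
    length-filter≤filter+∁ []       = z≤n
    length-filter≤filter+∁ (x ∷ xs) with ih ← length-filter≤filter+∁ xs | P? x | Q? x | R? x
    ... | yes px | yes qx | yes _  = s≤s ih
    ... | yes px | yes qx | no ¬rx = contradiction (P∩Q⊆R px qx) ¬rx
    ... | yes _  | no _   | yes _  = s≤s (≤-trans ih (+-monoʳ-≤ _ (n≤1+n _)))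
    ... | yes _  | no _   | no _   = ≤-trans (s≤s ih) (≤-reflexive (sym (+-suc _ _)))
    ... | no _   | yes _  | yes _  = m≤n⇒m≤1+n ih
    ... | no _   | yes _  | no _   = ih
    ... | no _   | no _   | yes _  = m≤n⇒m≤1+n (≤-trans ih (+-monoʳ-≤ _ (n≤1+n _)))
    ... | no _   | no _   | no _   = ≤-trans ih (+-monoʳ-≤ _ (n≤1+n _))

module _ {a b p} {A : Set a} {B : Set b} {P : A → B → Set p} (P? : ∀ i → Decidable (P i))
         {D : ℕ} (xs : List B) (few-misses : ∀ i → length (filter (∁? (P? i)) xs) ≤ D) where

  union-bound : ∀ is → length xs ≤ length (filter (λ x → all? (λ i → P? i x) is) xs) + length is * D
  union-bound [] rewrite filter-all (λ x → all? (λ i → P? i x) []) (All.universal (λ _ → []) xs) =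
    m≤m+n (length xs) 0
  union-bound (i ∷ is) = begin
    length xs                                     ≤⟨ union-bound is ⟩
    length (filter good? xs) + length is * D      ≤⟨ +-monoˡ-≤ (length is * D) drop-i ⟩
    good∷ + length (filter (∁? (P? i)) xs) + length is * D
                                                  ≤⟨ +-monoˡ-≤ (length is * D) misses-i≤D ⟩
    good∷ + D + length is * D                     ≡⟨ +-assoc good∷ D _ ⟩
    good∷ + length (i ∷ is) * D                   ∎
    where
    open ≤-Reasoning
    good?  = λ x → all? (λ i → P? i x) is
    good∷? = λ x → all? (λ i → P? i x) (i ∷ is)
    good∷  = length (filter good∷? xs)
    drop-i = length-filter≤filter+∁ good? (P? i) good∷? (λ good pi → pi ∷ good) xs
    misses-i≤D = +-monoʳ-≤ good∷ (few-misses i)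

colorBlock : ℕ → List ℕ
colorBlock k = applyUpTo (2 ^ k +_) (2 ^ k)

length-colorBlock : ∀ k → length (colorBlock k) ≡ 2 ^ k
length-colorBlock k = length-applyUpTo (2 ^ k +_) (2 ^ k)

colorBlock-unique : ∀ k → Unique (colorBlock k)
colorBlock-unique k =
  Unique.applyUpTo⁺₁ (2 ^ k +_) (2 ^ k) (λ i<j _ → <⇒≢ i<j ∘ +-cancelˡ-≡ (2 ^ k) _ _)

∈-colorBlock⁺ : ∀ {k r} → 2 ^ k ≤ r → r < 2 ^ suc k → r ∈ colorBlock k
∈-colorBlock⁺ {k} {r} lo hi =
  subst (_∈ colorBlock k) (m+[n∸m]≡n lo) (∈-applyUpTo⁺ (2 ^ k +_) offset<)
  where
  offset< : r ∸ 2 ^ k < 2 ^ k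
  offset< = +-cancelˡ-< (2 ^ k) _ _
    (subst₂ _<_ (sym (m+[n∸m]≡n lo)) (cong (2 ^ k +_) (+-identityʳ (2 ^ k))) hi)

∈-insertColor⁻ : ∀ {x} r xs → x ∈ insertColor r xs → x ∈ xs ⊎ x ≡ r
∈-insertColor⁻ r xs x∈ with r ∈? xs
∈-insertColor⁻ r xs x∈         | yes _ = inj₁ x∈
∈-insertColor⁻ r xs (here x≡r) | no _  = inj₂ x≡r
∈-insertColor⁻ r xs (there x∈) | no _  = inj₁ x∈

length-insertColor : ∀ r xs → length xs ≤ length (insertColor r xs)
length-insertColor r xs with r ∈? xs
... | yes _ = ≤-refl
... | no _  = n≤1+n _

Unique-insertColor : ∀ r {xs} → Unique xs → Unique (insertColor r xs)
Unique-insertColor r {xs} uxs with r ∈? xs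
... | yes _ = uxs
... | no r∉ = ¬Any⇒All¬ xs r∉ ∷ uxs

if-suc-cases : ∀ b p → (if b then suc p else p) ≡ p ⊎ ((if b then suc p else p) ≡ suc p × T b)
if-suc-cases true  p = inj₂ (refl , _)
if-suc-cases false p = inj₁ refl

module _ {n : ℕ} where

  Adds : Fin n → ℕ → ℕ → Subset n × ℕ × ℕ → Set
  Adds i j x (S , k , r) = i ∈ₛ S × k ≡ j × r ≡ x

  ColorInBlock : Subset n × ℕ × ℕ → Set
  ColorInBlock (_ , k , r) = r ∈ colorBlock k

  module _ (st : State n) (S : Subset n) (k r : ℕ) (i : Fin n) where

    C-step : ∀ j → (i ∈ₛ S × k ≡ j × C (step st S k r) i j ≡ insertColor r (C st i j))
                   ⊎ C (step st S k r) i j ≡ C st i j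
    C-step j with i Subset.∈? S | j ≟ k
    ... | yes i∈S | yes refl = inj₁ (i∈S , refl , refl)
    ... | yes _   | no _     = inj₂ refl
    ... | no _    | _        = inj₂ refl

    -- The second `with` is needed: the membership test inside the threshold of `step`
    -- only becomes visible, and hence abstractable, once the first one has been taken.
    phase-step : phase (step st S k r) i ≡ phase st i
               ⊎ (phase (step st S k r) i ≡ suc (phase st i)
                  × qParam n (phase st i) ≤ length (C (step st S k r) i (phase st i)))
    phase-step with i Subset.∈? S
    ... | no _    = inj₁ refl
    ... | yes i∈S with i Subset.∈? S
    ...   | yes _  = Sum.map₂ (Product.map₂ (≤ᵇ⇒≤ _ _)) (if-suc-cases _ _)
    ...   | no i∉S = contradiction i∈S i∉S

    ∈-C-step : ∀ {j x} → x ∈ C (step st S k r) i j → x ∈ C st i j ⊎ Adds i j x (S , k , r)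
    ∈-C-step {j} {x} x∈ with C-step j
    ... | inj₂ eq               = inj₁ (subst (x ∈_) eq x∈)
    ... | inj₁ (i∈S , k≡j , eq) =
      Sum.map₂ (λ x≡r → i∈S , k≡j , sym x≡r) (∈-insertColor⁻ r _ (subst (x ∈_) eq x∈))

    length-C-step : ∀ j → length (C st i j) ≤ length (C (step st S k r) i j)
    length-C-step j with C-step j
    ... | inj₁ (_ , _ , eq) = subst (λ c → length (C st i j) ≤ length c) (sym eq)
                                    (length-insertColor r (C st i j))
    ... | inj₂ eq           = ≤-reflexive (cong length (sym eq))

    Unique-C-step : ∀ j → Unique (C st i j) → Unique (C (step st S k r) i j)
    Unique-C-step j u with C-step j
    ... | inj₁ (_ , _ , eq) = subst Unique (sym eq) (Unique-insertColor r u)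
    ... | inj₂ eq           = subst Unique (sym eq) u

  ∈-C-run : ∀ st xs {i j x} → x ∈ C (run st xs) i j → x ∈ C st i j ⊎ Any (Adds i j x) xs
  ∈-C-run st []                 x∈ = inj₁ x∈
  ∈-C-run st ((S , k , r) ∷ xs) x∈ with ∈-C-run (step st S k r) xs x∈
  ... | inj₂ adds = inj₂ (there adds)
  ... | inj₁ x∈′  = Sum.map₂ here (∈-C-step st S k r _ x∈′)

  run-preserves : (Inv : State n → Set) → (∀ {st S k r} → Inv st → Inv (step st S k r)) →
                  ∀ {st} xs → Inv st → Inv (run st xs)
  run-preserves Inv inv-step []                 inv = inv
  run-preserves Inv inv-step ((S , k , r) ∷ xs) inv = run-preserves Inv inv-step xs (inv-step inv)

  ColorSetsUnique : State n → Set
  ColorSetsUnique st = ∀ i j → Unique (C st i j)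

  CompletedPhasesFilled : State n → Set
  CompletedPhasesFilled st = ∀ i k → k < phase st i → qParam n k ≤ length (C st i k)

  ColorSetsUnique-step : ∀ {st S k r} → ColorSetsUnique st → ColorSetsUnique (step st S k r)
  ColorSetsUnique-step {st} {S} {k} {r} u i j = Unique-C-step st S k r i j (u i j)

  CompletedPhasesFilled-step : ∀ {st S k r} →
    CompletedPhasesFilled st → CompletedPhasesFilled (step st S k r)
  CompletedPhasesFilled-step {st} {S} {k} {r} filled i j j<phase′ with phase-step st S k r i
  ... | inj₁ same = ≤-trans (filled i j (subst (j <_) same j<phase′)) (length-C-step st S k r i j)
  ... | inj₂ (advanced , threshold) with m≤n⇒m<n∨m≡n (subst (suc j ≤_) advanced j<phase′)
  ...   | inj₁ (s≤s j<phase) = ≤-trans (filled i j j<phase) (length-C-step st S k r i j)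
  ...   | inj₂ refl           = threshold

  ValidRun⇒All-ColorInBlock : ∀ {st} xs → ValidRun st xs → All ColorInBlock xs
  ValidRun⇒All-ColorInBlock []                 _                       = []
  ValidRun⇒All-ColorInBlock ((S , k , r) ∷ xs) (_ , (lo , hi) , valid) =
    ∈-colorBlock⁺ {k} lo hi ∷ ValidRun⇒All-ColorInBlock xs valid

  module _ (xs : List (Subset n × ℕ × ℕ)) where

    ∈-C-final : ∀ {i j x} → x ∈ C (run (initState n) xs) i j → Any (Adds i j x) xs
    ∈-C-final = [ (λ ()) , id ] ∘ ∈-C-run (initState n) xs

    C-final⊆colorBlock : ValidRun (initState n) xs →
                         ∀ i j → C (run (initState n) xs) i j ⊆ colorBlock j
    C-final⊆colorBlock valid i j x∈ =
      All.lookupWith inBlock∧adds (ValidRun⇒All-ColorInBlock xs valid) (∈-C-final x∈)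
      where
      inBlock∧adds : ∀ {x e} → ColorInBlock e → Adds i j x e → x ∈ colorBlock j
      inBlock∧adds r∈block (_ , refl , refl) = r∈block

    missed≤ : ValidRun (initState n) xs → ∀ i k → k < phase (run (initState n) xs) i →
              length (filter (∁? (_∈? C (run (initState n) xs) i k)) (colorBlock k))
                ≤ 2 ^ k ∸ qParam n k
    missed≤ valid i k k<phase = ≤-trans
      (length-filter-∁≤ (_∈? C final i k) (unique i k) (C-final⊆colorBlock valid i k) id)
      (∸-mono (≤-reflexive (length-colorBlock k)) (filled i k k<phase))
      where
      final = run (initState n) xs
      unique : ColorSetsUnique final
      unique = run-preserves ColorSetsUnique ColorSetsUnique-step xs (λ _ _ → [])
      filled : CompletedPhasesFilled final
      filled = run-preserves CompletedPhasesFilled CompletedPhasesFilled-step xs (λ _ _ ())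

    gatheredByAll⇒FullyUsed : ∀ {j x} → (∀ i → x ∈ C (run (initState n) xs) i j) → FullyUsed xs x
    gatheredByAll⇒FullyUsed gathered i =
      Any.map (λ (i∈S , _ , r≡x) → i∈S , r≡x) (∈-C-final (gathered i))

Unique-FullyUsed⇒length≤randValue : ∀ {n} (xs : List (Subset (suc n) × ℕ × ℕ)) {cs} → Unique cs →
                                     (∀ {c} → c ∈ cs → FullyUsed xs c) → length cs ≤ randValue xs
Unique-FullyUsed⇒length≤randValue xs ucs full = Unique-⊆⇒length≤ ucs λ c∈cs →
  ∈-filter⁺ (fullyUsed? xs) (∈-deduplicate⁺ _≟_ (used (full c∈cs))) (full c∈cs)
  where
  used : ∀ {c} → FullyUsed xs c → c ∈ map (proj₂ ∘ proj₂) xs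
  used full = Any.map⁺ (Any.map (sym ∘ proj₂) (full zero))

m≤ceilDivSuc*suc : ∀ m d → m ≤ ceilDivSuc m d * suc d
m≤ceilDivSuc*suc m d = +-cancelʳ-≤ d m (ceilDivSuc m d * suc d) (begin
  m + d                                    ≡⟨ m≡m%n+[m/n]*n (m + d) (suc d) ⟩
  (m + d) % suc d + ceilDivSuc m d * suc d ≤⟨ +-monoˡ-≤ _ (s≤s⁻¹ (m%n<n (m + d) (suc d))) ⟩
  d + ceilDivSuc m d * suc d               ≡⟨ +-comm d _ ⟩
  ceilDivSuc m d * suc d + d               ∎)
  where open ≤-Reasoning

ceilDivSuc-slack : ∀ m P → suc m * (P ∸ ceilDivSuc (m * P) m) ≤ P
ceilDivSuc-slack m P = begin
  suc m * (P ∸ c)       ≡⟨ *-distribˡ-∸ (suc m) P c ⟩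
  suc m * P ∸ suc m * c ≤⟨ ∸-monoʳ-≤ (suc m * P) mP≤[m+1]c ⟩
  P + m * P ∸ m * P     ≡⟨ m+n∸n≡m P (m * P) ⟩
  P                     ∎
  where
  open ≤-Reasoning
  c = ceilDivSuc (m * P) m
  mP≤[m+1]c : m * P ≤ suc m * c
  mP≤[m+1]c = subst (m * P ≤_) (*-comm c (suc m)) (m≤ceilDivSuc*suc (m * P) m)

-- 2 * suc n and suc (2 * suc n ∸ 1) are definitionally equal.
qParam-slack : ∀ n k → 2 * suc n * (2 ^ k ∸ qParam (suc n) k) ≤ 2 ^ k
qParam-slack n k = ceilDivSuc-slack (2 * suc n ∸ 1) (2 ^ k)

m≤n+o∧2o≤m⇒m≤2n : ∀ {m n o} → m ≤ n + o → 2 * o ≤ m → m ≤ 2 * n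
m≤n+o∧2o≤m⇒m≤2n {m} {n} {o} m≤n+o 2o≤m = +-cancelʳ-≤ m m (2 * n) (begin
  m + m         ≡⟨ cong (m +_) (+-identityʳ m) ⟨
  2 * m         ≤⟨ *-monoʳ-≤ 2 m≤n+o ⟩
  2 * (n + o)   ≡⟨ *-distribˡ-+ 2 n o ⟩
  2 * n + 2 * o ≤⟨ +-monoʳ-≤ (2 * n) 2o≤m ⟩
  2 * n + m     ∎)
  where open ≤-Reasoning

lemma1 : (n : ℕ) → 2 ≤ n → (E : List (Subset n)) → All Nonempty E →
    (choices : List (ℕ × ℕ)) → length choices ≡ length E →
    ValidRun (initState n) (zip E choices) →
    (ℓ : ℕ) → ((i : Fin n) → suc ℓ ≤ phase (run (initState n) (zip E choices)) i) →
    2 ^ ℓ ≤ 2 * randValue (zip E choices)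
lemma1 (suc n) _ E _ choices _ valid ℓ done = begin
  2 ^ ℓ               ≤⟨ m≤n+o∧2o≤m⇒m≤2n {n = length gathered} {o = suc n * D} covered slack ⟩
  2 * length gathered ≤⟨ *-monoʳ-≤ 2 (Unique-FullyUsed⇒length≤randValue xs
                           (Unique.filter⁺ gathered? (colorBlock-unique ℓ)) fully) ⟩
  2 * randValue xs    ∎
  where
  open ≤-Reasoning
  xs    = zip E choices
  final = run (initState (suc n)) xs
  D     = 2 ^ ℓ ∸ qParam (suc n) ℓ

  gathered? : Decidable (λ r → All (λ i → r ∈ C final i ℓ) (allFin (suc n)))
  gathered? r = all? (λ i → r ∈? C final i ℓ) (allFin (suc n))
  gathered : List ℕ
  gathered = filter gathered? (colorBlock ℓ)

  covered : 2 ^ ℓ ≤ length gathered + suc n * D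
  covered = begin
    2 ^ ℓ                              ≡⟨ length-colorBlock ℓ ⟨
    length (colorBlock ℓ)              ≤⟨ union-bound gathers? (colorBlock ℓ) missed nodes ⟩
    length gathered + length nodes * D ≡⟨ cong ((length gathered +_) ∘ (_* D)) length-nodes ⟩
    length gathered + suc n * D        ∎
    where
    gathers? = λ i r → r ∈? C final i ℓ
    missed   = λ i → missed≤ xs valid i ℓ (done i)
    nodes    = allFin (suc n)
    length-nodes = length-tabulate {n = suc n} id

  slack : 2 * (suc n * D) ≤ 2 ^ ℓ
  slack = subst (_≤ 2 ^ ℓ) (*-assoc 2 (suc n) D) (qParam-slack n ℓ)

  fully : ∀ {r} → r ∈ gathered → FullyUsed xs r
  fully r∈ = gatheredByAll⇒FullyUsed xs λ i →
    All.lookup (proj₂ (∈-filter⁻ gathered? {xs = colorBlock ℓ} r∈)) (∈-allFin i)
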